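{- For a prime $p$ and $\gamma\in\overline{\mathbf{F}}_p^{\times}$ let $$C_\gamma=\Bigl\{\begin{pmatrix}\gamma&t\\0&\gamma^{ -1}\end{pmatrix}: t\in\overline{\mathbf{F}}_p\Bigr\}.$$ For any prime $p\geq3$, any $\gamma\in\overline{\mathbf{F}}_p^{\times}$, any $x\in\mathrm{SL}_2(\overline{\mathbf{F}}_p)$ and any symmetric generating set $H$ of $\mathrm{SL}_2(\mathbf{F}_p)$ containing $1$, $$|H\cap xC_\gamma x^{ -1}|\leq 2\alpha^2|H|^{1/3},\qquad\alpha=\frac{|H\cdot H\cdot H|}{|H|}.$$ -}

module Defs where

open import Level using (Level; _⊔_)
open import Data.Nat using (ℕ; zero; suc; _≤_; NonZero) renaming (_+_ to _+ℕ_; _*_ to _*ℕ_)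
open import Data.Nat.DivMod using (_%_; _mod_)
open import Data.Fin using (Fin; toℕ)
open import Data.List using (List; []; _∷_; length; map; foldr)
open import Data.Product using (Σ; ∃; _×_)
open import Relation.Binary.PropositionalEquality using (_≡_)
open import Relation.Nullary using (¬_)
open import Algebra.Bundles using (CommutativeRing)

record Mat {a} (A : Set a) : Set a where
  constructor mat
  field
    m₁₁ m₁₂ m₂₁ m₂₂ : A

-- Matrices over F_p = Fin p (arithmetic mod p)

module Fp (p : ℕ) .{{_ : NonZero p}} where

  [_] : ℕ → Fin p
  [ n ] = n mod p

  _·_ : Mat (Fin p) → Mat (Fin p) → Mat (Fin p)
  mat a b c d · mat a' b' c' d' =
    mat [ toℕ a *ℕ toℕ a' +ℕ toℕ b *ℕ toℕ c' ] [ toℕ a *ℕ toℕ b' +ℕ toℕ b *ℕ toℕ d' ]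
        [ toℕ c *ℕ toℕ a' +ℕ toℕ d *ℕ toℕ c' ] [ toℕ c *ℕ toℕ b' +ℕ toℕ d *ℕ toℕ d' ]

  𝟙 : Mat (Fin p)
  𝟙 = mat [ 1 ] [ 0 ] [ 0 ] [ 1 ]

  IsSL : Mat (Fin p) → Set
  IsSL (mat a b c d) = (toℕ a *ℕ toℕ d) % p ≡ (toℕ b *ℕ toℕ c +ℕ 1) % p

module FieldDefs {c ℓ} (K : CommutativeRing c ℓ) where
  open CommutativeRing K

  IsField : Set (c ⊔ ℓ)
  IsField = (¬ (1# ≈ 0#)) × (∀ x → ¬ (x ≈ 0#) → ∃ λ y → x * y ≈ 1#)

  ι : ℕ → Carrier
  ι zero = 0#
  ι (suc n) = 1# + ι n

  HasChar : ℕ → Set ℓ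
  HasChar p = ι p ≈ 0#

  pow : Carrier → ℕ → Carrier
  pow x zero = 1#
  pow x (suc n) = x * pow x n

  eval : List Carrier → Carrier → Carrier
  eval [] x = 0#
  eval (c₀ ∷ cs) x = c₀ + x * eval cs x

  -- root of the monic polynomial  x^(length cs) + Σ cs_i x^i
  MonicRoot : List Carrier → Carrier → Set ℓ
  MonicRoot cs x = pow x (length cs) + eval cs x ≈ 0#

  AlgClosed : Set (c ⊔ ℓ)
  AlgClosed = ∀ (cs : List Carrier) → 1 ≤ length cs → ∃ λ x → MonicRoot cs x

  AlgebraicOverPrime : Set (c ⊔ ℓ)
  AlgebraicOverPrime =
    ∀ x → Σ (List ℕ) λ ns → 1 ≤ length ns × MonicRoot (map ι ns) x

  IsAlgClosureOfFp : ℕ → Set (c ⊔ ℓ)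
  IsAlgClosureOfFp p = IsField × HasChar p × AlgClosed × AlgebraicOverPrime

  _·K_ : Mat Carrier → Mat Carrier → Mat Carrier
  mat a b c d ·K mat a' b' c' d' =
    mat (a * a' + b * c') (a * b' + b * d') (c * a' + d * c') (c * b' + d * d')

  _≈M_ : Mat Carrier → Mat Carrier → Set ℓ
  mat a b c d ≈M mat a' b' c' d' = (a ≈ a') × (b ≈ b') × (c ≈ c') × (d ≈ d')

  IsSLK : Mat Carrier → Set ℓ
  IsSLK (mat a b c d) = a * d - b * c ≈ 1#

  -- inverse of a matrix of determinant 1
  adj : Mat Carrier → Mat Carrier
  adj (mat a b c d) = mat d (- b) (- c) a

  embed : ∀ {p} → Mat (Fin p) → Mat Carrier
  embed (mat a b c d) = mat (ι (toℕ a)) (ι (toℕ b)) (ι (toℕ c)) (ι (toℕ d))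

  -- g ∈ x C_γ x⁻¹  where  C_γ = { (γ t ; 0 γ⁻¹) : t ∈ K },  δ = γ⁻¹
  InConjC : ∀ {p} → Mat Carrier → Carrier → Carrier → Mat (Fin p) → Set (c ⊔ ℓ)
  InConjC x γ δ g = ∃ λ t → embed g ≈M ((x ·K mat γ t 0# δ) ·K adj x)

module Submission where

-- Let ψ(A) = x⁻¹ A x, computed in SL₂(K); ψ sends N into the
-- family C(t) = (γ t ; 0 γ⁻¹).
--  (1) Since H generates SL₂(F_p) and no conjugate makes both elementary
--      unipotents upper triangular, some g ∈ H has ψ(g) = G not upper
--      triangular.
--  (2) The lower-left entry of G C(t) G⁻¹ is affine in t with slope -G₂₁²,
--      so at most one n ∈ N is exceptional (makes it vanish); let N₂ be N
--      without it.
--  (3) When the middle factor is not exceptional, C(t₁) · G C(t₂) G⁻¹ · C(t₃)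
--      determines t₁, t₂, t₃.  Hence (n₁, n₂, n₃, k₁, k₂) ↦
--      (n₁ g k₁, k₁⁻¹ n₂ k₂, k₂⁻¹ g⁻¹ n₃) is injective from N × N₂ × N × H × H
--      to T³: the k's telescope away in the product of the three components.
--  (4) So |N|²(|N| - 1)|H|² ≤ |T|³, and with |H| ≤ |T| arithmetic gives the
--      bound.
-- Equality in K is undecidable, so (1) and (2) are classical; they are used
-- under double negation, which is harmless as the goal is decidable.

open import Defs
open import Algebra.Bundles using (CommutativeRing; Monoid)
open import Data.Nat using (ℕ; NonZero)
open import Data.Fin using (Fin)
open import Relation.Binary.PropositionalEquality using (_≡_)
open import Data.Nat.Primality using (Prime)

-- The map ι : ℕ → K, n ↦ n·1, is a semiring homomorphism into any
-- commutative ring; it extends to ℤ, which makes the ring solver with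
-- integer coefficients available over K.
module IntegerCoefficients {o ℓ} (K : CommutativeRing o ℓ) where
  open import Data.Nat as ℕ using (zero; suc)
  import Data.Nat.Properties as ℕ
  open import Data.Integer as ℤ using (ℤ; +_; -[1+_]; _⊖_)
  import Data.Integer.Properties as ℤ
  import Data.Sign as Sign
  open import Data.Maybe using (Maybe; just; nothing)
  open import Relation.Nullary using (yes; no)
  import Relation.Binary.PropositionalEquality as ≡
  import Algebra.Solver.Ring.AlmostCommutativeRing as ACR
  open CommutativeRing K
  open FieldDefs K using (ι)
  open import Algebra.Properties.Ring ring using (-‿distribˡ-*; -‿distribʳ-*; -‿involutive; -‿+-comm; -0#≈0#)
  open import Relation.Binary.Reasoning.Setoid setoid

  ι-+ : ∀ m n → ι (m ℕ.+ n) ≈ ι m + ι n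
  ι-+ zero    n = sym (+-identityˡ _)
  ι-+ (suc m) n = trans (+-congˡ (ι-+ m n)) (sym (+-assoc _ _ _))

  ι-* : ∀ m n → ι (m ℕ.* n) ≈ ι m * ι n
  ι-* zero    n = sym (zeroˡ _)
  ι-* (suc m) n = begin
    ι (n ℕ.+ m ℕ.* n)     ≈⟨ ι-+ n (m ℕ.* n) ⟩
    ι n + ι (m ℕ.* n)     ≈⟨ +-cong (sym (*-identityˡ _)) (ι-* m n) ⟩
    1# * ι n + ι m * ι n  ≈⟨ distribʳ _ _ _ ⟨
    (1# + ι m) * ι n      ∎

  ι-1 : ι 1 ≈ 1#
  ι-1 = +-identityʳ 1#

  ι-∸ : ∀ m n → n ℕ.≤ m → ι (m ℕ.∸ n) ≈ ι m - ι n
  ι-∸ m n n≤m = begin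
    ι (m ℕ.∸ n)                ≈⟨ +-identityʳ _ ⟨
    ι (m ℕ.∸ n) + 0#           ≈⟨ +-congˡ (-‿inverseʳ _) ⟨
    ι (m ℕ.∸ n) + (ι n - ι n)  ≈⟨ +-assoc _ _ _ ⟨
    (ι (m ℕ.∸ n) + ι n) - ι n  ≈⟨ +-congʳ (ι-+ (m ℕ.∸ n) n) ⟨
    ι (m ℕ.∸ n ℕ.+ n) - ι n    ≡⟨ ≡.cong (λ k → ι k - ι n) (ℕ.m∸n+n≡m n≤m) ⟩
    ι m - ι n                  ∎

  ⟦_⟧ᵢ : ℤ → Carrier
  ⟦ + n ⟧ᵢ      = ι n
  ⟦ -[1+ n ] ⟧ᵢ = - ι (suc n)

  ⟦-⟧ᵢ : ∀ z → ⟦ ℤ.- z ⟧ᵢ ≈ - ⟦ z ⟧ᵢ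
  ⟦-⟧ᵢ (+ zero)   = sym -0#≈0#
  ⟦-⟧ᵢ (+ suc n)  = refl
  ⟦-⟧ᵢ -[1+ n ]   = sym (-‿involutive _)

  ⟦⊖⟧ᵢ : ∀ m n → ⟦ m ⊖ n ⟧ᵢ ≈ ι m - ι n
  ⟦⊖⟧ᵢ m n with m ℕ.<? n
  ... | no m≮n rewrite ℤ.⊖-≥ (ℕ.≮⇒≥ m≮n) = ι-∸ m n (ℕ.≮⇒≥ m≮n)
  ... | yes m<n rewrite ℤ.⊖-< m<n = begin
    ⟦ ℤ.- (+ (n ℕ.∸ m)) ⟧ᵢ  ≈⟨ ⟦-⟧ᵢ (+ (n ℕ.∸ m)) ⟩
    - ι (n ℕ.∸ m)          ≈⟨ -‿cong (ι-∸ n m (ℕ.<⇒≤ m<n)) ⟩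
    - (ι n - ι m)          ≈⟨ -‿+-comm _ _ ⟨
    - ι n - - ι m          ≈⟨ +-congˡ (-‿involutive _) ⟩
    - ι n + ι m            ≈⟨ +-comm _ _ ⟩
    ι m - ι n              ∎

  ⟦+⟧ᵢ : ∀ a b → ⟦ a ℤ.+ b ⟧ᵢ ≈ ⟦ a ⟧ᵢ + ⟦ b ⟧ᵢ
  ⟦+⟧ᵢ (+ m)    (+ n)    = ι-+ m n
  ⟦+⟧ᵢ (+ m)    -[1+ n ] = ⟦⊖⟧ᵢ m (suc n)
  ⟦+⟧ᵢ -[1+ m ] (+ n)    = trans (⟦⊖⟧ᵢ n (suc m)) (+-comm _ _)
  ⟦+⟧ᵢ -[1+ m ] -[1+ n ] = begin
    - ι (suc (suc (m ℕ.+ n)))  ≡⟨ ≡.cong (λ k → - ι k) (ℕ.+-suc (suc m) n) ⟨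
    - ι (suc m ℕ.+ suc n)      ≈⟨ -‿cong (ι-+ (suc m) (suc n)) ⟩
    - (ι (suc m) + ι (suc n))  ≈⟨ -‿+-comm _ _ ⟨
    - ι (suc m) - ι (suc n)    ∎

  ⟦+◃⟧ᵢ : ∀ k → ⟦ Sign.+ ℤ.◃ k ⟧ᵢ ≈ ι k
  ⟦+◃⟧ᵢ zero    = refl
  ⟦+◃⟧ᵢ (suc k) = refl

  ⟦-◃⟧ᵢ : ∀ k → ⟦ Sign.- ℤ.◃ k ⟧ᵢ ≈ - ι k
  ⟦-◃⟧ᵢ zero    = sym -0#≈0#
  ⟦-◃⟧ᵢ (suc k) = refl

  ⟦*⟧ᵢ : ∀ a b → ⟦ a ℤ.* b ⟧ᵢ ≈ ⟦ a ⟧ᵢ * ⟦ b ⟧ᵢ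
  ⟦*⟧ᵢ (+ m)    (+ n)    = trans (⟦+◃⟧ᵢ (m ℕ.* n)) (ι-* m n)
  ⟦*⟧ᵢ (+ m)    -[1+ n ] = begin
    ⟦ Sign.- ℤ.◃ m ℕ.* suc n ⟧ᵢ  ≈⟨ ⟦-◃⟧ᵢ (m ℕ.* suc n) ⟩
    - ι (m ℕ.* suc n)           ≈⟨ -‿cong (ι-* m (suc n)) ⟩
    - (ι m * ι (suc n))         ≈⟨ -‿distribʳ-* _ _ ⟩
    ι m * - ι (suc n)           ∎
  ⟦*⟧ᵢ -[1+ m ] (+ n)    = begin
    ⟦ Sign.- ℤ.◃ suc m ℕ.* n ⟧ᵢ  ≈⟨ ⟦-◃⟧ᵢ (suc m ℕ.* n) ⟩
    - ι (suc m ℕ.* n)           ≈⟨ -‿cong (ι-* (suc m) n) ⟩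
    - (ι (suc m) * ι n)         ≈⟨ -‿distribˡ-* _ _ ⟩
    - ι (suc m) * ι n           ∎
  ⟦*⟧ᵢ -[1+ m ] -[1+ n ] = begin
    ι (suc m ℕ.* suc n)          ≈⟨ ι-* (suc m) (suc n) ⟩
    ι (suc m) * ι (suc n)        ≈⟨ -‿involutive _ ⟨
    - - (ι (suc m) * ι (suc n))  ≈⟨ -‿cong (-‿distribʳ-* _ _) ⟩
    - (ι (suc m) * - ι (suc n))  ≈⟨ -‿distribˡ-* _ _ ⟩
    - ι (suc m) * - ι (suc n)    ∎

  -- The same map, normalised so that the numeral 1 is sent to 1# on the
  -- nose: the solver's constants then match the literals 0# and 1#.
  numeral : ℕ → Carrier
  numeral zero          = 0#
  numeral (suc zero)    = 1#
  numeral (suc (suc n)) = 1# + numeral (suc n)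

  numeral≈ι : ∀ n → numeral n ≈ ι n
  numeral≈ι zero          = refl
  numeral≈ι (suc zero)    = sym ι-1
  numeral≈ι (suc (suc n)) = +-congˡ (numeral≈ι (suc n))

  ⟦_⟧ : ℤ → Carrier
  ⟦ + n ⟧      = numeral n
  ⟦ -[1+ n ] ⟧ = - numeral (suc n)

  ⟦⟧≈⟦⟧ᵢ : ∀ z → ⟦ z ⟧ ≈ ⟦ z ⟧ᵢ
  ⟦⟧≈⟦⟧ᵢ (+ n)      = numeral≈ι n
  ⟦⟧≈⟦⟧ᵢ -[1+ n ]   = -‿cong (numeral≈ι (suc n))

  homomorphism : ℤ.+-*-rawRing ACR.-Raw-AlmostCommutative⟶ ACR.fromCommutativeRing K
  homomorphism = record
    { ⟦_⟧    = ⟦_⟧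
    ; +-homo = λ a b → transport (a ℤ.+ b) (⟦+⟧ᵢ a b) (+-cong (⟦⟧≈⟦⟧ᵢ a) (⟦⟧≈⟦⟧ᵢ b))
    ; *-homo = λ a b → transport (a ℤ.* b) (⟦*⟧ᵢ a b) (*-cong (⟦⟧≈⟦⟧ᵢ a) (⟦⟧≈⟦⟧ᵢ b))
    ; -‿homo = λ a → transport (ℤ.- a) (⟦-⟧ᵢ a) (-‿cong (⟦⟧≈⟦⟧ᵢ a))
    ; 0-homo = refl
    ; 1-homo = refl
    }
    where
    transport : ∀ z {x y} → ⟦ z ⟧ᵢ ≈ x → y ≈ x → ⟦ z ⟧ ≈ y
    transport z zx yx = trans (⟦⟧≈⟦⟧ᵢ z) (trans zx (sym yx))

  -- equal integer coefficients have equal images (all the solver needs)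
  coefficient≟ : ∀ a b → Maybe (⟦ a ⟧ ≈ ⟦ b ⟧)
  coefficient≟ a b with a ℤ.≟ b
  ... | yes ≡.refl = just refl
  ... | no _       = nothing

  open import Algebra.Solver.Ring ℤ.+-*-rawRing (ACR.fromCommutativeRing K) homomorphism coefficient≟ public
    using (solve; _:=_; _:+_; _:*_; _:-_; :-_; con)

module Telescope {o ℓ} (M : Monoid o ℓ) where
  open Monoid M
  open import Relation.Binary.Reasoning.Setoid setoid
  open import Algebra.Solver.Monoid M using (_⊕_; _⊜_; id) renaming (solve to rearrange)

  telescope : ∀ {a a′ b b′} x y w z → a ∙ a′ ≈ ε → b ∙ b′ ≈ ε →
    ((x ∙ a) ∙ ((a′ ∙ y) ∙ b)) ∙ ((b′ ∙ w) ∙ z) ≈ ((x ∙ y) ∙ w) ∙ z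
  telescope {a} {a′} {b} {b′} x y w z aa′≈ε bb′≈ε = begin
    ((x ∙ a) ∙ ((a′ ∙ y) ∙ b)) ∙ ((b′ ∙ w) ∙ z)  ≈⟨ rearrange 8 (λ x a a′ y b b′ w z →
                                                      ((x ⊕ a) ⊕ ((a′ ⊕ y) ⊕ b)) ⊕ ((b′ ⊕ w) ⊕ z)
                                                      ⊜ (((x ⊕ (a ⊕ a′)) ⊕ y) ⊕ (b ⊕ b′)) ⊕ (w ⊕ z))
                                                    refl x a a′ y b b′ w z ⟩
    (((x ∙ (a ∙ a′)) ∙ y) ∙ (b ∙ b′)) ∙ (w ∙ z)  ≈⟨ ∙-congʳ (∙-cong (∙-congʳ (∙-congˡ aa′≈ε)) bb′≈ε) ⟩
    (((x ∙ ε) ∙ y) ∙ ε) ∙ (w ∙ z)               ≈⟨ rearrange 4 (λ x y w z → (((x ⊕ id) ⊕ y) ⊕ id) ⊕ (w ⊕ z)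
                                                                          ⊜ ((x ⊕ y) ⊕ w) ⊕ z) refl x y w z ⟩
    ((x ∙ y) ∙ w) ∙ z                           ∎

module Matrices {o ℓ} (K : CommutativeRing o ℓ) where
  open import Data.Product using (_,_)
  open import Data.Integer using (+_)
  open import Relation.Binary.Structures using (IsEquivalence)
  open CommutativeRing K
  open FieldDefs K using (_·K_; _≈M_; adj)
  open IntegerCoefficients K using (solve; _:=_; _:+_; _:*_; _:-_; :-_; con)
  open import Relation.Binary.Reasoning.Setoid setoid

  I : Mat Carrier
  I = mat 1# 0# 0# 1#

  det : Mat Carrier → Carrier
  det (mat a b c d) = a * d - b * c

  ≈M-isEquivalence : IsEquivalence _≈M_
  ≈M-isEquivalence = record
    { refl  = refl , refl , refl , refl
    ; sym   = λ (p , q , r , s) → sym p , sym q , sym r , sym s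
    ; trans = λ (p , q , r , s) (p′ , q′ , r′ , s′) → trans p p′ , trans q q′ , trans r r′ , trans s s′
    }

  open IsEquivalence ≈M-isEquivalence public
    using () renaming (refl to ≈M-refl; reflexive to ≈M-reflexive; sym to ≈M-sym; trans to ≈M-trans)

  ·K-cong : ∀ {A A′ B B′} → A ≈M A′ → B ≈M B′ → (A ·K B) ≈M (A′ ·K B′)
  ·K-cong (p , q , r , s) (p′ , q′ , r′ , s′) =
    +-cong (*-cong p p′) (*-cong q r′) , +-cong (*-cong p q′) (*-cong q s′) ,
    +-cong (*-cong r p′) (*-cong s r′) , +-cong (*-cong r q′) (*-cong s s′)

  ·K-assoc : ∀ A B C → ((A ·K B) ·K C) ≈M (A ·K (B ·K C))
  ·K-assoc (mat a b c d) (mat e f g h) (mat i j k l) =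
    entry a b i k , entry a b j l , entry c d i k , entry c d j l
    where
    entry : ∀ x y z w → (x * e + y * g) * z + (x * f + y * h) * w ≈ x * (e * z + f * w) + y * (g * z + h * w)
    entry = solve 8 (λ e f g h x y z w → (x :* e :+ y :* g) :* z :+ (x :* f :+ y :* h) :* w
                                       := x :* (e :* z :+ f :* w) :+ y :* (g :* z :+ h :* w)) refl e f g h

  1x+0y≈x : ∀ x y → 1# * x + 0# * y ≈ x
  1x+0y≈x x y = trans (+-cong (*-identityˡ x) (zeroˡ y)) (+-identityʳ x)

  0x+1y≈y : ∀ x y → 0# * x + 1# * y ≈ y
  0x+1y≈y x y = trans (+-cong (zeroˡ x) (*-identityˡ y)) (+-identityˡ y)

  ·K-identityˡ : ∀ A → (I ·K A) ≈M A
  ·K-identityˡ (mat a b c d) = 1x+0y≈x a c , 1x+0y≈x b d , 0x+1y≈y a c , 0x+1y≈y b d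

  ·K-identityʳ : ∀ A → (A ·K I) ≈M A
  ·K-identityʳ (mat a b c d) =
    trans (+-cong (*-comm a 1#) (*-comm b 0#)) (1x+0y≈x a b) ,
    trans (+-cong (*-comm a 0#) (*-comm b 1#)) (0x+1y≈y a b) ,
    trans (+-cong (*-comm c 1#) (*-comm d 0#)) (1x+0y≈x c d) ,
    trans (+-cong (*-comm c 0#) (*-comm d 1#)) (0x+1y≈y c d)

  M₂ : Monoid o ℓ
  M₂ = record
    { Carrier  = Mat Carrier
    ; _≈_      = _≈M_
    ; _∙_      = _·K_
    ; ε        = I
    ; isMonoid = record
      { isSemigroup = record
        { isMagma = record { isEquivalence = ≈M-isEquivalence ; ∙-cong = ·K-cong }
        ; assoc   = ·K-assoc }
      ; identity = ·K-identityˡ , ·K-identityʳ } }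

  det-· : ∀ A B → det (A ·K B) ≈ det A * det B
  det-· (mat a b c d) (mat e f g h) =
    solve 8 (λ a b c d e f g h → (a :* e :+ b :* g) :* (c :* f :+ d :* h) :- (a :* f :+ b :* h) :* (c :* e :+ d :* g)
               := (a :* d :- b :* c) :* (e :* h :- f :* g)) refl a b c d e f g h

  det-adj : ∀ A → det (adj A) ≈ det A
  det-adj (mat a b c d) = solve 4 (λ a b c d → d :* a :- (:- b) :* (:- c) := a :* d :- b :* c) refl a b c d

  unimodular-· : ∀ {A B} → det A ≈ 1# → det B ≈ 1# → det (A ·K B) ≈ 1#
  unimodular-· {A} {B} detA≈1 detB≈1 = trans (det-· A B) (trans (*-cong detA≈1 detB≈1) (*-identityˡ 1#))

  det-conjugate : ∀ X A → det X ≈ 1# → det ((adj X ·K A) ·K X) ≈ det A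
  det-conjugate X A det-X = begin
    det ((adj X ·K A) ·K X)          ≈⟨ det-· (adj X ·K A) X ⟩
    det (adj X ·K A) * det X         ≈⟨ *-congʳ (det-· (adj X) A) ⟩
    (det (adj X) * det A) * det X    ≈⟨ *-cong (*-congʳ (trans (det-adj X) det-X)) det-X ⟩
    (1# * det A) * 1#                ≈⟨ trans (*-identityʳ _) (*-identityˡ _) ⟩
    det A                            ∎

  adj-inverseˡ : ∀ A → det A ≈ 1# → (adj A ·K A) ≈M I
  adj-inverseˡ (mat a b c d) det≈1 =
    trans (solve 4 (λ a b c d → d :* a :+ (:- b) :* c := a :* d :- b :* c) refl a b c d) det≈1 ,
    solve 2 (λ b d → d :* b :+ (:- b) :* d := con (+ 0)) refl b d ,
    solve 2 (λ a c → (:- c) :* a :+ a :* c := con (+ 0)) refl a c ,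
    trans (solve 4 (λ a b c d → (:- c) :* b :+ a :* d := a :* d :- b :* c) refl a b c d) det≈1

  adj-inverseʳ : ∀ A → det A ≈ 1# → (A ·K adj A) ≈M I
  adj-inverseʳ (mat a b c d) det≈1 =
    trans (solve 4 (λ a b c d → a :* d :+ b :* (:- c) := a :* d :- b :* c) refl a b c d) det≈1 ,
    solve 2 (λ a b → a :* (:- b) :+ b :* a := con (+ 0)) refl a b ,
    solve 2 (λ c d → c :* d :+ d :* (:- c) := con (+ 0)) refl c d ,
    trans (solve 4 (λ a b c d → c :* (:- b) :+ d :* a := a :* d :- b :* c) refl a b c d) det≈1

  -- The first column of a unimodular matrix is not nilpotent:
  -- 1 = (ad - bc)³ lies in the ideal generated by a² and c².
  unimodular⇒column-not-nilpotent : ∀ A → det A ≈ 1# →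
    Mat.m₁₁ A * Mat.m₁₁ A ≈ 0# → Mat.m₂₁ A * Mat.m₂₁ A ≈ 0# → 1# ≈ 0#
  unimodular⇒column-not-nilpotent (mat a b c d) det≈1 a²≈0 c²≈0 = begin
    1#                          ≈⟨ trans (*-identityˡ _) (*-identityˡ _) ⟨
    1# * (1# * 1#)              ≈⟨ *-cong det≈1 (*-cong det≈1 det≈1) ⟨
    det A * (det A * det A)     ≈⟨ solve 4 (λ a b c d →
                                     (a :* d :- b :* c) :* ((a :* d :- b :* c) :* (a :* d :- b :* c))
                                     := (a :* a) :* (a :* d :* d :* d :- con (+ 3) :* d :* d :* b :* c)
                                        :+ (c :* c) :* (con (+ 3) :* a :* d :* b :* b :- b :* b :* b :* c))
                                   refl a b c d ⟩
    (a * a) * _ + (c * c) * _   ≈⟨ +-cong (trans (*-congʳ a²≈0) (zeroˡ _)) (trans (*-congʳ c²≈0) (zeroˡ _)) ⟩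
    0# + 0#                     ≈⟨ +-identityʳ 0# ⟩
    0#                          ∎
    where
    A : Mat Carrier
    A = mat a b c d

  Upper : Mat Carrier → Set ℓ
  Upper A = Mat.m₂₁ A ≈ 0#

  ≈M-₂₁ : ∀ {A B} → A ≈M B → Mat.m₂₁ A ≈ Mat.m₂₁ B
  ≈M-₂₁ (_ , _ , eq , _) = eq

  Upper-resp : ∀ {A B} → A ≈M B → Upper B → Upper A
  Upper-resp A≈B B-upper = trans (≈M-₂₁ A≈B) B-upper

  upper-· : ∀ A B → Upper A → Upper B → Upper (A ·K B)
  upper-· (mat a b c d) (mat a′ b′ c′ d′) c≈0 c′≈0 =
    trans (+-cong (trans (*-congʳ c≈0) (zeroˡ a′)) (trans (*-congˡ c′≈0) (zeroʳ d))) (+-identityʳ 0#)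

  U L : Mat Carrier
  U = mat 1# 1# 0# 1#
  L = mat 1# 0# 1# 1#

module Unimodular {o ℓ} (K : CommutativeRing o ℓ) where
  open import Data.Integer using (+_)
  open import Data.Empty using (⊥)
  open import Relation.Nullary using (¬_)
  open CommutativeRing K
  open FieldDefs K using (_·K_; _≈M_; adj)
  open IntegerCoefficients K using (solve; _:=_; _:+_; _:*_; :-_; con)
  open Matrices K
  open import Algebra.Properties.Ring ring using (-‿involutive; -0#≈0#)
  open import Relation.Binary.Reasoning.Setoid (Monoid.setoid M₂)
  open import Algebra.Properties.Monoid M₂ using (cancelˡ; cancelʳ; insertˡ; insertʳ; cancelᶜ; elimˡ; elimʳ)
  open import Algebra.Solver.Monoid M₂ using (_⊕_; _⊜_) renaming (solve to rearrange)

  cancelˡ-unimodular : ∀ B {A A′} → det B ≈ 1# → (B ·K A) ≈M (B ·K A′) → A ≈M A′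
  cancelˡ-unimodular B {A} {A′} det≈1 eq = begin
    A                   ≈⟨ insertˡ (adj-inverseˡ B det≈1) A ⟩
    adj B ·K (B ·K A)   ≈⟨ ·K-cong ≈M-refl eq ⟩
    adj B ·K (B ·K A′)  ≈⟨ cancelˡ (adj-inverseˡ B det≈1) A′ ⟩
    A′                  ∎

  cancelʳ-unimodular : ∀ B {A A′} → det B ≈ 1# → (A ·K B) ≈M (A′ ·K B) → A ≈M A′
  cancelʳ-unimodular B {A} {A′} det≈1 eq = begin
    A                   ≈⟨ insertʳ (adj-inverseʳ B det≈1) A ⟩
    (A ·K B) ·K adj B   ≈⟨ ·K-cong eq ≈M-refl ⟩
    (A′ ·K B) ·K adj B  ≈⟨ cancelʳ (adj-inverseʳ B det≈1) A′ ⟩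
    A′                  ∎

  module Conjugation (X : Mat Carrier) (det-X : det X ≈ 1#) where
    conj : Mat Carrier → Mat Carrier
    conj M = (adj X ·K M) ·K X

    conj-cong : ∀ {A B} → A ≈M B → conj A ≈M conj B
    conj-cong A≈B = ·K-cong (·K-cong ≈M-refl A≈B) ≈M-refl

    conj-· : ∀ A B → conj (A ·K B) ≈M (conj A ·K conj B)
    conj-· A B = begin
      (adj X ·K (A ·K B)) ·K X                   ≈⟨ rearrange 4 (λ x′ a b x → (x′ ⊕ (a ⊕ b)) ⊕ x ⊜ (x′ ⊕ a) ⊕ (b ⊕ x))
                                                                ≈M-refl (adj X) A B X ⟩
      (adj X ·K A) ·K (B ·K X)                   ≈⟨ cancelᶜ (adj-inverseʳ X det-X) (adj X ·K A) (B ·K X) ⟨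
      ((adj X ·K A) ·K X) ·K (adj X ·K (B ·K X))  ≈⟨ ·K-cong ≈M-refl (·K-assoc (adj X) B X) ⟨
      conj A ·K conj B                           ∎

    conj-I : conj I ≈M I
    conj-I = ≈M-trans (·K-cong (·K-identityʳ (adj X)) ≈M-refl) (adj-inverseˡ X det-X)

    conj-adj : ∀ M → conj ((X ·K M) ·K adj X) ≈M M
    conj-adj M = begin
      (adj X ·K ((X ·K M) ·K adj X)) ·K X  ≈⟨ rearrange 3 (λ x′ x m → (x′ ⊕ ((x ⊕ m) ⊕ x′)) ⊕ x
                                                                ⊜ (x′ ⊕ x) ⊕ (m ⊕ (x′ ⊕ x))) ≈M-refl (adj X) X M ⟩
      (adj X ·K X) ·K (M ·K (adj X ·K X))  ≈⟨ elimˡ (adj-inverseˡ X det-X) (M ·K (adj X ·K X)) ⟩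
      M ·K (adj X ·K X)                    ≈⟨ elimʳ (adj-inverseˡ X det-X) M ⟩
      M                                    ∎

    conj-injective : ∀ {A B} → conj A ≈M conj B → A ≈M B
    conj-injective eq =
      cancelˡ-unimodular (adj X) (trans (det-adj X) det-X) (cancelʳ-unimodular X det-X eq)

    det-conj : ∀ A → det (conj A) ≈ det A
    det-conj A = det-conjugate X A det-X

    -- No unimodular conjugate makes both U and L upper triangular: for
    -- X = (a b ; c d) the two lower-left entries are -c² and a².
    not-both-upper : ¬ (1# ≈ 0#) → Upper (conj U) → Upper (conj L) → ⊥
    not-both-upper 1≉0 U-upper L-upper = 1≉0 (unimodular⇒column-not-nilpotent X det-X a²≈0 c²≈0)
      where
      a c : Carrier
      a = Mat.m₁₁ X
      c = Mat.m₂₁ X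
      a²≈0 : a * a ≈ 0#
      a²≈0 = trans (solve 2 (λ a c → a :* a := ((:- c) :* con (+ 1) :+ a :* con (+ 1)) :* a
                                              :+ ((:- c) :* con (+ 0) :+ a :* con (+ 1)) :* c) refl a c)
                   L-upper
      c²≈0 : c * c ≈ 0#
      c²≈0 = trans (sym (-‿involutive _)) (trans (-‿cong (trans
               (solve 2 (λ a c → :- (c :* c) := ((:- c) :* con (+ 1) :+ a :* con (+ 0)) :* a
                                              :+ ((:- c) :* con (+ 1) :+ a :* con (+ 1)) :* c) refl a c)
               U-upper)) -0#≈0#)

module FieldFacts {o ℓ} (K : CommutativeRing o ℓ) (isField : FieldDefs.IsField K) where
  open import Data.Product using (_,_; proj₁; proj₂)
  open import Relation.Nullary using (¬_)
  open CommutativeRing K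
  open import Algebra.Properties.Group +-group using (∙-cancelˡ)
  open import Relation.Binary.Reasoning.Setoid setoid

  1≉0 : ¬ (1# ≈ 0#)
  1≉0 = proj₁ isField

  *-cancelˡ-nonzero : ∀ {u a b} → ¬ (u ≈ 0#) → u * a ≈ u * b → a ≈ b
  *-cancelˡ-nonzero {u} {a} {b} u≉0 ua≈ub with proj₂ isField u u≉0
  ... | v , uv≈1 = begin
    a            ≈⟨ *-identityˡ a ⟨
    1# * a       ≈⟨ *-congʳ uv≈1 ⟨
    (u * v) * a  ≈⟨ *-congʳ (*-comm u v) ⟩
    (v * u) * a  ≈⟨ *-assoc v u a ⟩
    v * (u * a)  ≈⟨ *-congˡ ua≈ub ⟩
    v * (u * b)  ≈⟨ *-assoc v u b ⟨
    (v * u) * b  ≈⟨ *-congʳ (*-comm v u) ⟩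
    (u * v) * b  ≈⟨ *-congʳ uv≈1 ⟩
    1# * b       ≈⟨ *-identityˡ b ⟩
    b            ∎

  nonzero-* : ∀ {a b} → ¬ (a ≈ 0#) → ¬ (b ≈ 0#) → ¬ (a * b ≈ 0#)
  nonzero-* {a} a≉0 b≉0 ab≈0 = b≉0 (*-cancelˡ-nonzero a≉0 (trans ab≈0 (sym (zeroʳ a))))

  invertible⇒nonzero : ∀ {a b} → a * b ≈ 1# → ¬ (a ≈ 0#)
  invertible⇒nonzero {a} {b} ab≈1 a≈0 = 1≉0 (trans (sym ab≈1) (trans (*-congʳ a≈0) (zeroˡ b)))

  affine-injective : ∀ {u b s s′} → ¬ (u ≈ 0#) → b + u * s ≈ b + u * s′ → s ≈ s′
  affine-injective {b = b} u≉0 eq = *-cancelˡ-nonzero u≉0 (∙-cancelˡ b _ _ eq)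

module TriangularFamily {o ℓ} (K : CommutativeRing o ℓ) (isField : FieldDefs.IsField K)
    (γ δ : CommutativeRing.Carrier K)
    (γδ≈1 : CommutativeRing._≈_ K (CommutativeRing._*_ K γ δ) (CommutativeRing.1# K)) where
  open import Data.Product using (_×_; _,_; proj₁; proj₂)
  open import Data.Integer using (+_)
  open import Relation.Nullary using (¬_)
  open CommutativeRing K
  open FieldDefs K using (_·K_; _≈M_; adj)
  open IntegerCoefficients K using (solve; _:=_; _:+_; _:*_; _:-_; :-_; con)
  open Matrices K using (·K-cong; ≈M-refl; ≈M-trans)
  open FieldFacts K isField
  open import Algebra.Properties.Ring ring using (-‿involutive; -0#≈0#)
  open import Relation.Binary.Reasoning.Setoid setoid

  C : Carrier → Mat Carrier
  C t = mat γ t 0# δ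

  C-cong : ∀ {t t′} → t ≈ t′ → C t ≈M C t′
  C-cong t≈t′ = refl , t≈t′ , refl , refl

  sandwich₂₁ : ∀ s W u → Mat.m₂₁ ((C s ·K W) ·K C u) ≈ Mat.m₂₁ W
  sandwich₂₁ s (mat w₁₁ w₁₂ w₂₁ w₂₂) u = begin
    (0# * w₁₁ + δ * w₂₁) * γ + (0# * w₁₂ + δ * w₂₂) * 0#  ≈⟨ solve 6 (λ γ δ w₁₁ w₁₂ w₂₁ w₂₂ →
        (con (+ 0) :* w₁₁ :+ δ :* w₂₁) :* γ :+ (con (+ 0) :* w₁₂ :+ δ :* w₂₂) :* con (+ 0) := (γ :* δ) :* w₂₁)
        refl γ δ w₁₁ w₁₂ w₂₁ w₂₂ ⟩
    (γ * δ) * w₂₁                                         ≈⟨ *-congʳ γδ≈1 ⟩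
    1# * w₂₁                                              ≈⟨ *-identityˡ w₂₁ ⟩
    w₂₁                                                   ∎

  sandwich₁₁ : ∀ s W u → Mat.m₁₁ ((C s ·K W) ·K C u) ≈ (γ * γ) * Mat.m₁₁ W + (γ * Mat.m₂₁ W) * s
  sandwich₁₁ s (mat w₁₁ w₁₂ w₂₁ w₂₂) u = solve 6 (λ γ s w₁₁ w₁₂ w₂₁ w₂₂ →
    (γ :* w₁₁ :+ s :* w₂₁) :* γ :+ (γ :* w₁₂ :+ s :* w₂₂) :* con (+ 0) := (γ :* γ) :* w₁₁ :+ (γ :* w₂₁) :* s)
    refl γ s w₁₁ w₁₂ w₂₁ w₂₂

  sandwich₂₂ : ∀ s W u → Mat.m₂₂ ((C s ·K W) ·K C u) ≈ (δ * δ) * Mat.m₂₂ W + (δ * Mat.m₂₁ W) * u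
  sandwich₂₂ s (mat w₁₁ w₁₂ w₂₁ w₂₂) u = solve 6 (λ δ u w₁₁ w₁₂ w₂₁ w₂₂ →
    (con (+ 0) :* w₁₁ :+ δ :* w₂₁) :* u :+ (con (+ 0) :* w₁₂ :+ δ :* w₂₂) :* δ := (δ :* δ) :* w₂₂ :+ (δ :* w₂₁) :* u)
    refl δ u w₁₁ w₁₂ w₂₁ w₂₂

  γ≉0 : ¬ (γ ≈ 0#)
  γ≉0 = invertible⇒nonzero γδ≈1

  δ≉0 : ¬ (δ ≈ 0#)
  δ≉0 = invertible⇒nonzero (trans (*-comm δ γ) γδ≈1)

  sandwich-injective : ∀ {s u s′ u′} W → ¬ (Mat.m₂₁ W ≈ 0#) →
    ((C s ·K W) ·K C u) ≈M ((C s′ ·K W) ·K C u′) → s ≈ s′ × u ≈ u′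
  sandwich-injective {s} {u} {s′} {u′} W W₂₁≉0 (eq₁₁ , _ , _ , eq₂₂) =
    affine-injective (nonzero-* γ≉0 W₂₁≉0) (trans (sym (sandwich₁₁ s W u)) (trans eq₁₁ (sandwich₁₁ s′ W u′))) ,
    affine-injective (nonzero-* δ≉0 W₂₁≉0) (trans (sym (sandwich₂₂ s W u)) (trans eq₂₂ (sandwich₂₂ s′ W u′)))

  conjugate : Mat Carrier → Carrier → Mat Carrier
  conjugate G t = (G ·K C t) ·K adj G

  conjugate-cong : ∀ G {t t′} → t ≈ t′ → conjugate G t ≈M conjugate G t′
  conjugate-cong G t≈t′ = ·K-cong (·K-cong ≈M-refl (C-cong t≈t′)) ≈M-refl

  conjugate₂₁ : ∀ G t → Mat.m₂₁ (conjugate G t) ≈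
    (Mat.m₂₁ G * γ * Mat.m₂₂ G - Mat.m₂₁ G * Mat.m₂₂ G * δ) + (- (Mat.m₂₁ G * Mat.m₂₁ G)) * t
  conjugate₂₁ (mat α β κ ε) t = solve 5 (λ γ δ κ ε t →
    (κ :* γ :+ ε :* con (+ 0)) :* ε :+ (κ :* t :+ ε :* δ) :* (:- κ) := (κ :* γ :* ε :- κ :* ε :* δ) :+ (:- (κ :* κ)) :* t)
    refl γ δ κ ε t

  conjugate₂₁-injective : ∀ G {t t′} → ¬ (Mat.m₂₁ G ≈ 0#) →
    Mat.m₂₁ (conjugate G t) ≈ Mat.m₂₁ (conjugate G t′) → t ≈ t′
  conjugate₂₁-injective G {t} {t′} G₂₁≉0 eq = affine-injective slope≉0
    (trans (sym (conjugate₂₁ G t)) (trans eq (conjugate₂₁ G t′)))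
    where
    slope≉0 : ¬ (- (Mat.m₂₁ G * Mat.m₂₁ G) ≈ 0#)
    slope≉0 slope≈0 = nonzero-* G₂₁≉0 G₂₁≉0 (trans (sym (-‿involutive _)) (trans (-‿cong slope≈0) -0#≈0#))

  triple-injective : ∀ G {t₁ t₂ t₃ t₁′ t₂′ t₃′} → ¬ (Mat.m₂₁ G ≈ 0#) → ¬ (Mat.m₂₁ (conjugate G t₂) ≈ 0#) →
    ((C t₁ ·K conjugate G t₂) ·K C t₃) ≈M ((C t₁′ ·K conjugate G t₂′) ·K C t₃′) →
    t₁ ≈ t₁′ × t₂ ≈ t₂′ × t₃ ≈ t₃′
  triple-injective G {t₁} {t₂} {t₃} {t₁′} {t₂′} {t₃′} G₂₁≉0 W₂₁≉0 eq =
    proj₁ outer , t₂≈t₂′ , proj₂ outer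
    where
    t₂≈t₂′ : t₂ ≈ t₂′
    t₂≈t₂′ = conjugate₂₁-injective G G₂₁≉0 (begin
      Mat.m₂₁ (conjugate G t₂)                               ≈⟨ sandwich₂₁ t₁ (conjugate G t₂) t₃ ⟨
      Mat.m₂₁ ((C t₁ ·K conjugate G t₂) ·K C t₃)             ≈⟨ proj₁ (proj₂ (proj₂ eq)) ⟩
      Mat.m₂₁ ((C t₁′ ·K conjugate G t₂′) ·K C t₃′)          ≈⟨ sandwich₂₁ t₁′ (conjugate G t₂′) t₃′ ⟩
      Mat.m₂₁ (conjugate G t₂′)                              ∎)
    same-middle : ((C t₁ ·K conjugate G t₂) ·K C t₃) ≈M ((C t₁′ ·K conjugate G t₂) ·K C t₃′)
    same-middle = ≈M-trans eq (·K-cong (·K-cong ≈M-refl (conjugate-cong G (sym t₂≈t₂′))) ≈M-refl)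
    outer : t₁ ≈ t₁′ × t₃ ≈ t₃′
    outer = sandwich-injective (conjugate G t₂) W₂₁≉0 same-middle

module ResidueMatrices (p : ℕ) .{{_ : NonZero p}} where
  open import Data.Nat using (_*_; _+_)
  import Data.Nat.Properties as ℕ
  open import Data.Fin using (toℕ)
  import Data.Fin.Properties as Fin
  open import Data.Nat.DivMod using (_%_; m%n<n; %-distribˡ-*; m*n%n≡0)
  open import Relation.Binary.PropositionalEquality using (trans; cong; cong₂; module ≡-Reasoning)
  open Fp p using ([_]; IsSL)

  toℕ-[] : ∀ n → toℕ [ n ] ≡ n % p
  toℕ-[] n = Fin.toℕ-fromℕ< (m%n<n n p)

  u l : Mat (Fin p)
  u = mat [ 1 ] [ 1 ] [ 0 ] [ 1 ]
  l = mat [ 1 ] [ 0 ] [ 1 ] [ 1 ]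

  -- both determinant conditions read  (1·1) mod p = (1·0 + 1) mod p
  private
    unit-determinant : (toℕ [ 1 ] * toℕ [ 1 ]) % p ≡ (toℕ [ 1 ] * toℕ [ 0 ] + 1) % p
    unit-determinant = begin
      (toℕ [ 1 ] * toℕ [ 1 ]) % p       ≡⟨ cong₂ (λ a b → (a * b) % p) (toℕ-[] 1) (toℕ-[] 1) ⟩
      ((1 % p) * (1 % p)) % p           ≡⟨ %-distribˡ-* 1 1 p ⟨
      1 % p                             ≡⟨ cong (λ z → (z + 1) % p) (ℕ.*-zeroʳ (toℕ [ 1 ])) ⟨
      (toℕ [ 1 ] * 0 + 1) % p           ≡⟨ cong (λ z → (toℕ [ 1 ] * z + 1) % p) (trans (toℕ-[] 0) (m*n%n≡0 0 p)) ⟨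
      (toℕ [ 1 ] * toℕ [ 0 ] + 1) % p   ∎
      where open ≡-Reasoning

  u-SL : IsSL u
  u-SL = unit-determinant

  l-SL : IsSL l
  l-SL = trans unit-determinant (cong (λ z → (z + 1) % p) (ℕ.*-comm (toℕ [ 1 ]) (toℕ [ 0 ])))

module Reduction {o ℓ} (K : CommutativeRing o ℓ) (p : ℕ) .{{_ : NonZero p}} (char : FieldDefs.HasChar K p) where
  open import Data.Nat as ℕ using (zero; suc)
  import Data.Nat.Properties as ℕ
  open import Data.Nat.DivMod using (_%_; _/_; m≡m%n+[m/n]*n)
  open import Data.Nat.Coprimality using (prime⇒coprime; coprime-Bézout)
  open import Data.Nat.GCD using (module Bézout)
  open import Data.Fin using (toℕ)
  import Data.Fin.Properties as Fin
  open import Data.Product using (_,_)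
  open import Data.Sum using (inj₁; inj₂)
  open import Data.Empty using (⊥-elim)
  open import Relation.Nullary using (¬_)
  import Relation.Binary.PropositionalEquality as ≡
  open CommutativeRing K
  open FieldDefs K using (ι; embed; _·K_; _≈M_; IsField)
  open IntegerCoefficients K using (ι-+; ι-*; ι-1; ι-∸)
  open Matrices K using (I; det; U; L)
  open ResidueMatrices p using (toℕ-[]; u; l)
  open Fp p using ([_]; _·_; 𝟙; IsSL)
  open import Relation.Binary.Reasoning.Setoid setoid

  E : Mat (Fin p) → Mat Carrier
  E = embed

  ι-*p : ∀ n → ι (n ℕ.* p) ≈ 0#
  ι-*p n = trans (ι-* n p) (trans (*-congˡ char) (zeroʳ _))

  ι-% : ∀ n → ι (n % p) ≈ ι n
  ι-% n = begin
    ι (n % p)                    ≈⟨ +-identityʳ _ ⟨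
    ι (n % p) + 0#               ≈⟨ +-congˡ (ι-*p (n / p)) ⟨
    ι (n % p) + ι (n / p ℕ.* p)  ≈⟨ ι-+ (n % p) _ ⟨
    ι (n % p ℕ.+ n / p ℕ.* p)    ≡⟨ ≡.cong ι (m≡m%n+[m/n]*n n p) ⟨
    ι n                          ∎

  ι-[] : ∀ n → ι (toℕ [ n ]) ≈ ι n
  ι-[] n = trans (reflexive (≡.cong ι (toℕ-[] n))) (ι-% n)

  E-· : ∀ A B → E (A · B) ≈M (E A ·K E B)
  E-· (mat a b c d) (mat a′ b′ c′ d′) =
    entry a a′ b c′ , entry a b′ b d′ , entry c a′ d c′ , entry c b′ d d′
    where
    entry : ∀ w x y z → ι (toℕ [ toℕ w ℕ.* toℕ x ℕ.+ toℕ y ℕ.* toℕ z ])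
                        ≈ ι (toℕ w) * ι (toℕ x) + ι (toℕ y) * ι (toℕ z)
    entry w x y z = trans (ι-[] _) (trans (ι-+ (toℕ w ℕ.* toℕ x) _) (+-cong (ι-* (toℕ w) _) (ι-* (toℕ y) _)))

  ι-[1] : ι (toℕ [ 1 ]) ≈ 1#
  ι-[1] = trans (ι-[] 1) ι-1

  E-𝟙 : E 𝟙 ≈M I
  E-𝟙 = ι-[1] , ι-[] 0 , ι-[] 0 , ι-[1]

  E-u : E u ≈M U
  E-u = ι-[1] , ι-[1] , ι-[] 0 , ι-[1]

  E-l : E l ≈M L
  E-l = ι-[1] , ι-[] 0 , ι-[1] , ι-[1]

  det-E : ∀ A → IsSL A → det (E A) ≈ 1#
  det-E (mat a b c d) ad≡bc+1 = begin
    ι (toℕ a) * ι (toℕ d) - ι (toℕ b) * ι (toℕ c)  ≈⟨ +-congʳ ad≈bc+1 ⟩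
    (ι (toℕ b) * ι (toℕ c) + 1#) - ι (toℕ b) * ι (toℕ c)  ≈⟨ +-congʳ (+-comm _ _) ⟩
    (1# + ι (toℕ b) * ι (toℕ c)) - ι (toℕ b) * ι (toℕ c)  ≈⟨ +-assoc _ _ _ ⟩
    1# + (ι (toℕ b) * ι (toℕ c) - ι (toℕ b) * ι (toℕ c))  ≈⟨ +-congˡ (-‿inverseʳ _) ⟩
    1# + 0#                                               ≈⟨ +-identityʳ 1# ⟩
    1#                                                    ∎
    where
    ad≈bc+1 : ι (toℕ a) * ι (toℕ d) ≈ ι (toℕ b) * ι (toℕ c) + 1#
    ad≈bc+1 = begin
      ι (toℕ a) * ι (toℕ d)                ≈⟨ ι-* (toℕ a) (toℕ d) ⟨
      ι (toℕ a ℕ.* toℕ d)                  ≈⟨ ι-% _ ⟨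
      ι ((toℕ a ℕ.* toℕ d) % p)            ≡⟨ ≡.cong ι ad≡bc+1 ⟩
      ι ((toℕ b ℕ.* toℕ c ℕ.+ 1) % p)      ≈⟨ ι-% _ ⟩
      ι (toℕ b ℕ.* toℕ c ℕ.+ 1)            ≈⟨ ι-+ (toℕ b ℕ.* toℕ c) 1 ⟩
      ι (toℕ b ℕ.* toℕ c) + ι 1            ≈⟨ +-cong (ι-* (toℕ b) (toℕ c)) ι-1 ⟩
      ι (toℕ b) * ι (toℕ c) + 1#           ∎

  -- Over a field, ι is injective on {0, …, p-1} when p is prime, by Bézout.
  module Injectivity (isField : IsField) (p-prime : Prime p) where
    open FieldFacts K isField using (1≉0)

    ι-1+*p : ∀ x → ι (1 ℕ.+ x ℕ.* p) ≈ 1#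
    ι-1+*p x = trans (ι-+ 1 (x ℕ.* p)) (trans (+-cong ι-1 (ι-*p x)) (+-identityʳ 1#))

    ι-nonzero : ∀ k → suc k ℕ.< p → ¬ (ι (suc k) ≈ 0#)
    ι-nonzero k k<p ιk≈0 with coprime-Bézout (prime⇒coprime p-prime k<p)
    ... | Bézout.Identity.+- x y 1+yk≡xp = 1≉0 (begin
      1#                       ≈⟨ +-identityʳ 1# ⟨
      1# + 0#                  ≈⟨ +-cong ι-1 (trans (ι-* y (suc k)) (trans (*-congˡ ιk≈0) (zeroʳ _))) ⟨
      ι 1 + ι (y ℕ.* suc k)    ≈⟨ ι-+ 1 (y ℕ.* suc k) ⟨
      ι (1 ℕ.+ y ℕ.* suc k)    ≡⟨ ≡.cong ι 1+yk≡xp ⟩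
      ι (x ℕ.* p)              ≈⟨ ι-*p x ⟩
      0#                       ∎)
    ... | Bézout.Identity.-+ x y 1+xp≡yk = 1≉0 (begin
      1#                       ≈⟨ ι-1+*p x ⟨
      ι (1 ℕ.+ x ℕ.* p)        ≡⟨ ≡.cong ι 1+xp≡yk ⟩
      ι (y ℕ.* suc k)          ≈⟨ ι-* y (suc k) ⟩
      ι y * ι (suc k)          ≈⟨ *-congˡ ιk≈0 ⟩
      ι y * 0#                 ≈⟨ zeroʳ _ ⟩
      0#                       ∎)

    ι-injective-≤ : ∀ {m n} → m ℕ.≤ n → n ℕ.< p → ι m ≈ ι n → m ≡ n
    ι-injective-≤ {m} {n} m≤n n<p ιm≈ιn with n ℕ.∸ m in n∸m≡
    ... | zero  = ℕ.≤-antisym m≤n (ℕ.m∸n≡0⇒m≤n n∸m≡)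
    ... | suc k = ⊥-elim (ι-nonzero k k<p ιk≈0)
      where
      k<p : suc k ℕ.< p
      k<p = ℕ.≤-<-trans (≡.subst (ℕ._≤ n) n∸m≡ (ℕ.m∸n≤m n m)) n<p
      ιk≈0 : ι (suc k) ≈ 0#
      ιk≈0 = ≡.subst (λ j → ι j ≈ 0#) n∸m≡ (trans (ι-∸ n m m≤n) (trans (+-congʳ (sym ιm≈ιn)) (-‿inverseʳ _)))

    ι-injective : ∀ (i j : Fin p) → ι (toℕ i) ≈ ι (toℕ j) → i ≡ j
    ι-injective i j ιi≈ιj with ℕ.≤-total (toℕ i) (toℕ j)
    ... | inj₁ i≤j = Fin.toℕ-injective (ι-injective-≤ i≤j (Fin.toℕ<n j) ιi≈ιj)
    ... | inj₂ j≤i = Fin.toℕ-injective (≡.sym (ι-injective-≤ j≤i (Fin.toℕ<n i) (sym ιi≈ιj)))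

    E-injective : ∀ {A B} → E A ≈M E B → A ≡ B
    E-injective {mat a b c d} {mat a′ b′ c′ d′} (a≈ , b≈ , c≈ , d≈)
      rewrite ι-injective a a′ a≈ | ι-injective b b′ b≈ | ι-injective c c′ c≈ | ι-injective d d′ d≈ = ≡.refl

module Counting where
  open import Data.Nat using (suc; _+_; _*_; _≤_; z≤n; s≤s)
  open import Data.List using (List; []; _∷_; length; map; cartesianProduct)
  import Data.List.Properties as List
  open import Data.List.Membership.Propositional using (_∈_)
  open import Data.List.Relation.Unary.Any using (here; there; _─_)
  import Data.List.Relation.Unary.All as All
  open import Data.List.Relation.Unary.All.Properties using (─⁺)
  open import Data.List.Relation.Unary.AllPairs using (_∷_)
  open import Data.List.Relation.Unary.Unique.Propositional using (Unique)
  open import Data.Product using (_,_)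
  open import Data.Empty using (⊥-elim)
  open import Relation.Binary.PropositionalEquality using (refl; sym; trans; cong₂; subst; _≢_)

  module _ {a} {A : Set a} where
    ─-⊆ : ∀ {x z : A} {ys} (x∈ : x ∈ ys) → z ∈ (ys ─ x∈) → z ∈ ys
    ─-⊆ (here _)  z∈       = there z∈
    ─-⊆ (there _) (here e) = here e
    ─-⊆ (there x∈) (there z∈) = there (─-⊆ x∈ z∈)

    ─-excludes : ∀ {x z : A} {ys} → Unique ys → (x∈ : x ∈ ys) → z ∈ (ys ─ x∈) → z ≢ x
    ─-excludes (y≢ ∷ _) (here refl) z∈ z≡x = All.lookup y≢ z∈ (sym z≡x)
    ─-excludes (y≢ ∷ _) (there x∈) (here refl) z≡x = All.lookup y≢ x∈ z≡x
    ─-excludes (_ ∷ u) (there x∈) (there z∈) = ─-excludes u x∈ z∈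

    ∈-─ : ∀ {x z : A} {ys} (x∈ : x ∈ ys) → z ∈ ys → z ≢ x → z ∈ (ys ─ x∈)
    ∈-─ (here refl) (here refl) z≢x = ⊥-elim (z≢x refl)
    ∈-─ (here refl) (there z∈)  _   = z∈
    ∈-─ (there _)   (here e)    _   = here e
    ∈-─ (there x∈)  (there z∈)  z≢x = there (∈-─ x∈ z∈ z≢x)

    ─-unique : ∀ {x : A} {ys} → Unique ys → (x∈ : x ∈ ys) → Unique (ys ─ x∈)
    ─-unique (_ ∷ u)   (here _)   = u
    ─-unique (y≢ ∷ u)  (there x∈) = ─⁺ x∈ y≢ ∷ ─-unique u x∈

  module _ {a b} {A : Set a} {B : Set b} where
    injection-length : ∀ (xs : List A) (ys : List B) (f : A → B) → Unique xs →
      (∀ {x} → x ∈ xs → f x ∈ ys) →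
      (∀ {x y} → x ∈ xs → y ∈ xs → f x ≡ f y → x ≡ y) → length xs ≤ length ys
    injection-length []       ys f _         _    _   = z≤n
    injection-length (x ∷ xs) ys f (x≢ ∷ u) into inj =
      subst (suc (length xs) ≤_) (sym (List.length-removeAt′ ys _))
        (s≤s (injection-length xs (ys ─ fx∈) f u into′ (λ x∈ y∈ → inj (there x∈) (there y∈))))
      where
      fx∈ : f x ∈ ys
      fx∈ = into (here refl)
      into′ : ∀ {y} → y ∈ xs → f y ∈ (ys ─ fx∈)
      into′ y∈ = ∈-─ fx∈ (into (there y∈)) (λ fy≡fx → All.lookup x≢ y∈ (sym (inj (there y∈) (here refl) fy≡fx)))

    length-cartesianProduct : ∀ (xs : List A) (ys : List B) → length (cartesianProduct xs ys) ≡ length xs * length ys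
    length-cartesianProduct []       ys = refl
    length-cartesianProduct (x ∷ xs) ys = trans (List.length-++ (map (x ,_) ys))
      (cong₂ _+_ (List.length-map (x ,_) ys) (length-cartesianProduct xs ys))

-- The final numerical step: from  n·m·n·h² ≤ t³,  n ≤ m + 1  and  h ≤ t
-- follows  n³h⁵ ≤ 8t⁶.  (For n ≤ 1 this is h⁵ ≤ 8t⁶; for n ≥ 2 one has
-- n ≤ 2m, whence n³h² ≤ 2t³.)
module Arithmetic where
  open import Data.Nat using (zero; suc; _≤_; _*_; _+_; _^_; z≤n; _≤?_)
  open import Data.Nat.Properties
  open import Data.Nat.Solver using (module +-*-Solver)
  open +-*-Solver using (solve; _:=_; _:*_; _:+_; _:^_; con)
  open import Relation.Nullary using (yes; no)
  open import Relation.Binary.PropositionalEquality using (refl)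
  open ≤-Reasoning

  t⁵≤8t⁶ : ∀ t → t ^ 5 ≤ 8 * t ^ 6
  t⁵≤8t⁶ zero    = z≤n
  t⁵≤8t⁶ (suc t) = begin
    suc t ^ 5          ≤⟨ m≤m*n (suc t ^ 5) (suc t) ⟩
    suc t ^ 5 * suc t  ≡⟨ solve 1 (λ x → x :^ 5 :* x := x :^ 6) refl (suc t) ⟩
    suc t ^ 6          ≤⟨ m≤n*m (suc t ^ 6) 8 ⟩
    8 * suc t ^ 6      ∎

  final-inequality : ∀ n m h t → n ≤ suc m → n * (m * (n * (h * h))) ≤ t * (t * t) → h ≤ t →
    n ^ 3 * h ^ 5 ≤ 8 * t ^ 6
  final-inequality n m h t n≤1+m count h≤t with n ≤? 1
  ... | yes n≤1 = begin
    n ^ 3 * h ^ 5  ≤⟨ *-monoˡ-≤ (h ^ 5) (^-monoˡ-≤ 3 n≤1) ⟩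
    1 ^ 3 * h ^ 5  ≡⟨ *-identityˡ (h ^ 5) ⟩
    h ^ 5          ≤⟨ ^-monoˡ-≤ 5 h≤t ⟩
    t ^ 5          ≤⟨ t⁵≤8t⁶ t ⟩
    8 * t ^ 6      ∎
  ... | no n≰1 = begin
    n ^ 3 * h ^ 5                                   ≡⟨ solve 2 (λ n h → n :^ 3 :* h :^ 5
                                                         := (n :* (n :* (n :* (h :* h)))) :* (h :* (h :* h))) refl n h ⟩
    (n * (n * (n * (h * h)))) * (h * (h * h))       ≤⟨ *-monoˡ-≤ (h * (h * h)) (*-monoˡ-≤ (n * (n * (h * h))) n≤2m) ⟩
    (2 * m * (n * (n * (h * h)))) * (h * (h * h))   ≡⟨ solve 3 (λ n m h → (con 2 :* m :* (n :* (n :* (h :* h)))) :* (h :* (h :* h))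
                                                         := con 2 :* (n :* (m :* (n :* (h :* h)))) :* (h :* (h :* h))) refl n m h ⟩
    2 * (n * (m * (n * (h * h)))) * (h * (h * h))   ≤⟨ *-mono-≤ (*-monoʳ-≤ 2 count) (*-mono-≤ h≤t (*-mono-≤ h≤t h≤t)) ⟩
    2 * (t * (t * t)) * (t * (t * t))               ≡⟨ solve 1 (λ t → con 2 :* (t :* (t :* t)) :* (t :* (t :* t)) := con 2 :* t :^ 6) refl t ⟩
    2 * t ^ 6                                       ≤⟨ *-monoˡ-≤ (t ^ 6) (m≤m+n 2 6) ⟩
    8 * t ^ 6                                       ∎
    where
    n≤2m : n ≤ 2 * m
    n≤2m = ≤-trans n≤1+m (begin
      1 + m      ≤⟨ +-monoˡ-≤ m (≤-pred (≤-trans (≰⇒> n≰1) n≤1+m)) ⟩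
      m + m      ≡⟨ solve 1 (λ m → m :+ m := con 2 :* m) refl m ⟩
      2 * m      ∎)

module Classical where
  open import Data.List using (List; []; _∷_; length)
  open import Data.List.Membership.Propositional using (_∈_)
  open import Data.List.Relation.Unary.Any using (here; there; _─_)
  open import Data.List.Relation.Unary.Unique.Propositional using (Unique)
  open import Data.List.Properties using (length-removeAt′)
  open import Data.Nat using (suc; _≤_)
  open import Data.Nat.Properties using (≤-reflexive; n≤1+n)
  open import Data.Product using (Σ; ∃; _×_; _,_)
  open import Relation.Nullary using (¬_; Dec; yes; no)
  open import Relation.Nullary.Decidable using (¬¬-excluded-middle)
  open import Relation.Binary.PropositionalEquality using (refl)
  open Counting

  module _ {a b} {A : Set a} {P : A → Set b} where
    ¬∀⇒¬¬∃¬ : ∀ (xs : List A) → ¬ (∀ {x} → x ∈ xs → P x) → ¬ ¬ (∃ λ x → x ∈ xs × ¬ P x)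
    ¬∀⇒¬¬∃¬ []       ¬all ¬∃ = ¬all (λ ())
    ¬∀⇒¬¬∃¬ (y ∷ ys) ¬all ¬∃ = ¬∀⇒¬¬∃¬ ys
      (λ all-ys → ¬∃ (y , here refl , λ Py → ¬all λ { (here refl) → Py ; (there x∈) → all-ys x∈ }))
      (λ (x , x∈ , ¬Px) → ¬∃ (x , there x∈ , ¬Px))

    drop-exceptional : ∀ {xs : List A} → Unique xs → (∀ {x y} → P x → P y → x ≡ y) →
      ¬ ¬ (Σ (List A) λ ys → Unique ys × (∀ {y} → y ∈ ys → y ∈ xs × ¬ P y) × length xs ≤ suc (length ys))
    drop-exceptional {xs} xs-unique at-most-one k = ¬¬-excluded-middle (λ dec → k (split dec))
      where
      split : Dec (∃ λ x → x ∈ xs × P x) →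
        Σ (List A) λ ys → Unique ys × (∀ {y} → y ∈ ys → y ∈ xs × ¬ P y) × length xs ≤ suc (length ys)
      split (yes (x , x∈ , Px)) =
        (xs ─ x∈) , ─-unique xs-unique x∈ ,
        (λ y∈ → ─-⊆ x∈ y∈ , λ Py → ─-excludes xs-unique x∈ y∈ (at-most-one Py Px)) ,
        ≤-reflexive (length-removeAt′ xs _)
      split (no none) = xs , xs-unique , (λ y∈ → y∈ , λ Py → none (_ , y∈ , Py)) , n≤1+n _

open import Level using (Level)
open import Data.Nat using (ℕ; _*_; _^_; _≤_; NonZero)
open import Data.Nat.Primality using (Prime)
open import Data.Fin using (Fin)
open import Data.List using (List; length; foldr)
open import Data.List.Membership.Propositional using (_∈_)
open import Data.List.Relation.Unary.All using (All)
open import Data.List.Relation.Unary.Unique.Propositional using (Unique)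
open import Data.Product using (Σ; ∃; _×_)
open import Function.Bundles using (_⇔_)
open import Relation.Binary.PropositionalEquality using (_≡_)
open import Algebra.Bundles using (CommutativeRing)
open import Data.Product using (_,_)

-- The argument, under the hypotheses of the theorem.
module ConjugateCosetBound {c ℓ : Level} (p : ℕ) .{{_ : NonZero p}} (p-prime : Prime p)
    (K : CommutativeRing c ℓ) (isField : FieldDefs.IsField K) (char : FieldDefs.HasChar K p)
    (γ δ : CommutativeRing.Carrier K)
    (γδ≈1 : CommutativeRing._≈_ K (CommutativeRing._*_ K γ δ) (CommutativeRing.1# K))
    (X : Mat (CommutativeRing.Carrier K)) (det-X : FieldDefs.IsSLK K X)
    (H : List (Mat (Fin p))) (H-unique : Unique H) (H-SL : All (Fp.IsSL p) H) (𝟙∈H : Fp.𝟙 p ∈ H)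
    (H-symmetric : ∀ {h} → h ∈ H → ∃ λ h′ → h′ ∈ H × Fp._·_ p h h′ ≡ Fp.𝟙 p)
    (H-generates : ∀ g → Fp.IsSL p g → ∃ λ ws → All (_∈ H) ws × foldr (Fp._·_ p) (Fp.𝟙 p) ws ≡ g)
    (T : List (Mat (Fin p)))
    (T-spec : ∀ g → g ∈ T ⇔ (∃ λ h₁ → ∃ λ h₂ → ∃ λ h₃ → h₁ ∈ H × h₂ ∈ H × h₃ ∈ H ×
                              g ≡ Fp._·_ p (Fp._·_ p h₁ h₂) h₃))
    (N : List (Mat (Fin p))) (N-unique : Unique N)
    (N-spec : ∀ g → g ∈ N ⇔ (g ∈ H × FieldDefs.InConjC K X γ δ g)) where

  open import Data.List using (_∷_)
  import Data.List.Relation.Unary.All as All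
  open import Data.List.Relation.Unary.All using ([]; _∷_)
  open import Data.List.Membership.Propositional.Properties using (∈-cartesianProduct⁺; ∈-cartesianProduct⁻)
  open import Data.Product using (_,_; proj₁; proj₂)
  open import Data.Empty using (⊥-elim)
  open import Function using (_∘_)
  open import Function.Bundles using (Equivalence)
  open import Relation.Nullary using (¬_; yes; no)
  open import Relation.Nullary.Decidable using (map′; _×-dec_)
  open import Relation.Binary.Definitions using (DecidableEquality)
  import Relation.Binary.PropositionalEquality as ≡
  open CommutativeRing K using (Carrier; _≈_; 1#; refl; sym; trans)
  open FieldDefs K using (_·K_; _≈M_; adj)
  open Fp p using (_·_; 𝟙; IsSL)
  open Matrices K
  open Unimodular K
  open Unimodular.Conjugation K X det-X
  open Reduction K p char using (E; E-·; E-𝟙; E-u; E-l; det-E)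
  open Reduction.Injectivity K p char isField p-prime using (E-injective)
  open TriangularFamily K isField γ δ γδ≈1 using (C; C-cong; conjugate; conjugate₂₁-injective; triple-injective)
  open FieldFacts K isField using (1≉0)
  open ResidueMatrices p using (u; l; u-SL; l-SL)
  open Classical

  ψ : Mat (Fin p) → Mat Carrier
  ψ A = conj (E A)

  ψ-· : ∀ A B → ψ (A · B) ≈M (ψ A ·K ψ B)
  ψ-· A B = ≈M-trans (conj-cong (E-· A B)) (conj-· (E A) (E B))

  ψ-·² : ∀ A B D → ψ ((A · B) · D) ≈M ((ψ A ·K ψ B) ·K ψ D)
  ψ-·² A B D = ≈M-trans (ψ-· (A · B) D) (·K-cong (ψ-· A B) ≈M-refl)

  ψ-𝟙 : ψ 𝟙 ≈M I
  ψ-𝟙 = ≈M-trans (conj-cong E-𝟙) conj-I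

  ψ-injective : ∀ {A B} → ψ A ≈M ψ B → A ≡ B
  ψ-injective ψA≈ψB = E-injective (conj-injective ψA≈ψB)

  det-ψ : ∀ A → IsSL A → det (ψ A) ≈ 1#
  det-ψ A A-SL = trans (det-conj (E A)) (det-E A A-SL)

  H-SL∋ : ∀ {h} → h ∈ H → IsSL h
  H-SL∋ = All.lookup H-SL

  N⊆H : ∀ {n} → n ∈ N → n ∈ H
  N⊆H {n} n∈N = proj₁ (Equivalence.to (N-spec n) n∈N)

  ψ-N : ∀ {n} → n ∈ N → ∃ λ t → ψ n ≈M C t
  ψ-N {n} n∈N with proj₂ (Equivalence.to (N-spec n) n∈N)
  ... | t , En≈ = t , ≈M-trans (conj-cong En≈) (conj-adj (C t))

  C-determines : ∀ {n n′ t t′} → ψ n ≈M C t → ψ n′ ≈M C t′ → t ≈ t′ → n ≡ n′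
  C-determines ψn≈ ψn′≈ t≈t′ = ψ-injective (≈M-trans ψn≈ (≈M-trans (C-cong t≈t′) (≈M-sym ψn′≈)))

  cancelˡ-SL² : ∀ a b {k k′} → IsSL a → IsSL b → (a · b) · k ≡ (a · b) · k′ → k ≡ k′
  cancelˡ-SL² a b {k} {k′} a-SL b-SL eq = ψ-injective
    (cancelˡ-unimodular (ψ a ·K ψ b) (unimodular-· (det-ψ a a-SL) (det-ψ b b-SL))
      (≈M-trans (≈M-sym (ψ-·² a b k)) (≈M-trans (≈M-reflexive (≡.cong ψ eq)) (ψ-·² a b k′))))

  cancelʳ-SL² : ∀ a b {k k′} → IsSL a → IsSL b → (k · a) · b ≡ (k′ · a) · b → k ≡ k′
  cancelʳ-SL² a b {k} {k′} a-SL b-SL eq = ψ-injective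
    (cancelʳ-unimodular (ψ a) (det-ψ a a-SL) (cancelʳ-unimodular (ψ b) (det-ψ b b-SL)
      (≈M-trans (≈M-sym (ψ-·² k a b)) (≈M-trans (≈M-reflexive (≡.cong ψ eq)) (ψ-·² k′ a b)))))

  cancelʳ-SL : ∀ a {k k′} → IsSL a → k · a ≡ k′ · a → k ≡ k′
  cancelʳ-SL a {k} {k′} a-SL eq = ψ-injective (cancelʳ-unimodular (ψ a) (det-ψ a a-SL)
    (≈M-trans (≈M-sym (ψ-· k a)) (≈M-trans (≈M-reflexive (≡.cong ψ eq)) (ψ-· k′ a))))

  -- matrices over F_p have decidable equality, so inverses in H can be
  -- chosen by a function
  _≟M_ : DecidableEquality (Mat (Fin p))
  mat a b c d ≟M mat a′ b′ c′ d′ =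
    map′ (λ { (≡.refl , ≡.refl , ≡.refl , ≡.refl) → ≡.refl }) (λ { ≡.refl → ≡.refl , ≡.refl , ≡.refl , ≡.refl })
         (a Data.Fin.≟ a′ ×-dec b Data.Fin.≟ b′ ×-dec c Data.Fin.≟ c′ ×-dec d Data.Fin.≟ d′)

  open import Data.List.Membership.DecPropositional _≟M_ using (_∈?_)

  inverse : Mat (Fin p) → Mat (Fin p)
  inverse h with h ∈? H
  ... | yes h∈H = proj₁ (H-symmetric h∈H)
  ... | no _    = h

  inverse-spec : ∀ {h} → h ∈ H → inverse h ∈ H × h · inverse h ≡ 𝟙
  inverse-spec {h} h∈H with h ∈? H
  ... | yes h∈H′ = proj₂ (H-symmetric h∈H′)
  ... | no h∉H   = ⊥-elim (h∉H h∈H)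

  ψ-inverse : ∀ {h} → h ∈ H → (ψ h ·K ψ (inverse h)) ≈M I
  ψ-inverse {h} h∈H = ≈M-trans (≈M-sym (ψ-· h (inverse h)))
    (≈M-trans (≈M-reflexive (≡.cong ψ (proj₂ (inverse-spec h∈H)))) ψ-𝟙)

  inverse-injective : ∀ {h h′} → h ∈ H → h′ ∈ H → inverse h ≡ inverse h′ → h ≡ h′
  inverse-injective {h} {h′} h∈H h′∈H eq = cancelʳ-SL (inverse h) (H-SL∋ (proj₁ (inverse-spec h∈H)))
    (≡.trans (proj₂ (inverse-spec h∈H)) (≡.trans (≡.sym (proj₂ (inverse-spec h′∈H))) (≡.cong (h′ ·_) (≡.sym eq))))

  -- Not every ψ h, h ∈ H, is upper triangular: otherwise every product of
  -- elements of H, hence (as H generates) all of SL₂(F_p), and in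
  -- particular u and l, would be sent to upper triangular matrices.
  upper-words : (∀ {h} → h ∈ H → Upper (ψ h)) → ∀ {ws} → All (_∈ H) ws → Upper (ψ (foldr _·_ 𝟙 ws))
  upper-words all-upper []             = Upper-resp ψ-𝟙 refl
  upper-words all-upper {h ∷ ws} (h∈H ∷ ws∈H) =
    Upper-resp (ψ-· h (foldr _·_ 𝟙 ws))
      (upper-· (ψ h) (ψ (foldr _·_ 𝟙 ws)) (all-upper h∈H) (upper-words all-upper ws∈H))

  not-all-upper : ¬ (∀ {h} → h ∈ H → Upper (ψ h))
  not-all-upper all-upper =
    not-both-upper 1≉0 (Upper-resp (conj-cong (≈M-sym E-u)) (upper-SL u u-SL))
                       (Upper-resp (conj-cong (≈M-sym E-l)) (upper-SL l l-SL))
    where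
    upper-SL : ∀ v → IsSL v → Upper (ψ v)
    upper-SL v v-SL with H-generates v v-SL
    ... | ws , ws∈H , ≡v = ≡.subst (Upper ∘ ψ) ≡v (upper-words all-upper ws∈H)

  generic-element : ¬ ¬ (∃ λ g → g ∈ H × ¬ Upper (ψ g))
  generic-element = ¬∀⇒¬¬∃¬ H not-all-upper

  module Generic {g} (g∈H : g ∈ H) (g-generic : ¬ Upper (ψ g)) where
    G : Mat Carrier
    G = ψ g

    g⁻¹ : Mat (Fin p)
    g⁻¹ = inverse g

    g⁻¹∈H : g⁻¹ ∈ H
    g⁻¹∈H = proj₁ (inverse-spec g∈H)

    ψg⁻¹≈adjG : ψ g⁻¹ ≈M adj G
    ψg⁻¹≈adjG = cancelˡ-unimodular G (det-ψ g (H-SL∋ g∈H))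
      (≈M-trans (ψ-inverse g∈H) (≈M-sym (adj-inverseʳ G (det-ψ g (H-SL∋ g∈H)))))

    Exceptional : Mat (Fin p) → Set (c Level.⊔ ℓ)
    Exceptional n = ∃ λ t → ψ n ≈M C t × Upper (conjugate G t)

    exceptional-unique : ∀ {n n′} → Exceptional n → Exceptional n′ → n ≡ n′
    exceptional-unique (t , ψn≈ , upper) (t′ , ψn′≈ , upper′) =
      C-determines ψn≈ ψn′≈ (conjugate₂₁-injective G g-generic (trans upper (sym upper′)))

    module Injection (N₂ : List (Mat (Fin p))) (N₂-unique : Unique N₂)
                     (N₂-good : ∀ {n} → n ∈ N₂ → n ∈ N × ¬ Exceptional n) where
      open import Data.List using (cartesianProduct)
      import Data.List.Relation.Unary.Unique.Propositional.Properties as Unique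
      open Counting using (injection-length; length-cartesianProduct)
      open Telescope M₂ using (telescope)
      open import Algebra.Solver.Monoid M₂ using (_⊕_; _⊜_) renaming (solve to rearrange)

      M : Set
      M = Mat (Fin p)

      Source : List (M × M × M × M × M)
      Source = cartesianProduct N (cartesianProduct N₂ (cartesianProduct N (cartesianProduct H H)))

      Target : List (M × M × M)
      Target = cartesianProduct T (cartesianProduct T T)

      f : M × M × M × M × M → M × M × M
      f (n₁ , n₂ , n₃ , k₁ , k₂) = (n₁ · g) · k₁ , (inverse k₁ · n₂) · k₂ , (inverse k₂ · g⁻¹) · n₃

      ∈-Source : ∀ {n₁ n₂ n₃ k₁ k₂} → (n₁ , n₂ , n₃ , k₁ , k₂) ∈ Source →
        n₁ ∈ N × n₂ ∈ N₂ × n₃ ∈ N × k₁ ∈ H × k₂ ∈ H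
      ∈-Source s∈ with ∈-cartesianProduct⁻ N _ s∈
      ... | n₁∈ , r₁ with ∈-cartesianProduct⁻ N₂ _ r₁
      ... | n₂∈ , r₂ with ∈-cartesianProduct⁻ N _ r₂
      ... | n₃∈ , r₃ with ∈-cartesianProduct⁻ H H r₃
      ... | k₁∈ , k₂∈ = n₁∈ , n₂∈ , n₃∈ , k₁∈ , k₂∈

      ∈-T : ∀ {a b d} → a ∈ H → b ∈ H → d ∈ H → (a · b) · d ∈ T
      ∈-T a∈ b∈ d∈ = Equivalence.from (T-spec _) (_ , _ , _ , a∈ , b∈ , d∈ , ≡.refl)

      f-into : ∀ {s} → s ∈ Source → f s ∈ Target
      f-into {n₁ , n₂ , n₃ , k₁ , k₂} s∈ with ∈-Source s∈
      ... | n₁∈ , n₂∈ , n₃∈ , k₁∈ , k₂∈ =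
        ∈-cartesianProduct⁺ (∈-T (N⊆H n₁∈) g∈H k₁∈)
          (∈-cartesianProduct⁺ (∈-T (proj₁ (inverse-spec k₁∈)) (N⊆H (proj₁ (N₂-good n₂∈))) k₂∈)
                               (∈-T (proj₁ (inverse-spec k₂∈)) g⁻¹∈H (N⊆H n₃∈)))

      -- multiplying out the three components of f, the k's cancel and
      -- what remains is a sandwich C(t₁) · G C(t₂) G⁻¹ · C(t₃)
      product : M × M × M → Mat Carrier
      product (a , b , d) = (ψ a ·K ψ b) ·K ψ d

      product-f : ∀ n₁ n₂ n₃ {k₁ k₂ t₁ t₂ t₃} → k₁ ∈ H → k₂ ∈ H →
        ψ n₁ ≈M C t₁ → ψ n₂ ≈M C t₂ → ψ n₃ ≈M C t₃ →
        product (f (n₁ , n₂ , n₃ , k₁ , k₂)) ≈M ((C t₁ ·K conjugate G t₂) ·K C t₃)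
      product-f n₁ n₂ n₃ {k₁} {k₂} {t₁} {t₂} {t₃} k₁∈ k₂∈ ψn₁≈ ψn₂≈ ψn₃≈ = begin
        product (f (n₁ , n₂ , n₃ , k₁ , k₂))
          ≈⟨ ·K-cong (·K-cong (ψ-·² n₁ g k₁) (ψ-·² (inverse k₁) n₂ k₂)) (ψ-·² (inverse k₂) g⁻¹ n₃) ⟩
        (((ψ n₁ ·K G) ·K ψ k₁) ·K ((ψ (inverse k₁) ·K ψ n₂) ·K ψ k₂)) ·K ((ψ (inverse k₂) ·K ψ g⁻¹) ·K ψ n₃)
          ≈⟨ telescope (ψ n₁ ·K G) (ψ n₂) (ψ g⁻¹) (ψ n₃) (ψ-inverse k₁∈) (ψ-inverse k₂∈) ⟩
        (((ψ n₁ ·K G) ·K ψ n₂) ·K ψ g⁻¹) ·K ψ n₃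
          ≈⟨ ·K-cong (·K-cong (·K-cong (·K-cong ψn₁≈ ≈M-refl) ψn₂≈) ψg⁻¹≈adjG) ψn₃≈ ⟩
        (((C t₁ ·K G) ·K C t₂) ·K adj G) ·K C t₃
          ≈⟨ rearrange 5 (λ a b d e h → (((a ⊕ b) ⊕ d) ⊕ e) ⊕ h ⊜ (a ⊕ ((b ⊕ d) ⊕ e)) ⊕ h)
                         ≈M-refl (C t₁) G (C t₂) (adj G) (C t₃) ⟩
        (C t₁ ·K conjugate G t₂) ·K C t₃
          ∎
        where open import Relation.Binary.Reasoning.Setoid (Monoid.setoid M₂)

      -- f s determines n₁, n₂, n₃: the sandwich determines t₁, t₂, t₃
      -- because n₂ is not exceptional
      f-determines-N : ∀ {n₁ n₂ n₃ k₁ k₂ n₁′ n₂′ n₃′ k₁′ k₂′} →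
        (n₁ , n₂ , n₃ , k₁ , k₂) ∈ Source → (n₁′ , n₂′ , n₃′ , k₁′ , k₂′) ∈ Source →
        f (n₁ , n₂ , n₃ , k₁ , k₂) ≡ f (n₁′ , n₂′ , n₃′ , k₁′ , k₂′) →
        n₁ ≡ n₁′ × n₂ ≡ n₂′ × n₃ ≡ n₃′
      f-determines-N {n₁} {n₂} {n₃} {_} {_} {n₁′} {n₂′} {n₃′} s∈ s′∈ fs≡fs′ =
        let (n₁∈ , n₂∈ , n₃∈ , k₁∈ , k₂∈)      = ∈-Source s∈
            (n₁′∈ , n₂′∈ , n₃′∈ , k₁′∈ , k₂′∈) = ∈-Source s′∈
            (n₂∈N , n₂-good) = N₂-good n₂∈
            (t₁ , ψn₁≈) = ψ-N n₁∈
            (t₂ , ψn₂≈) = ψ-N n₂∈N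
            (t₃ , ψn₃≈) = ψ-N n₃∈
            (t₁′ , ψn₁′≈) = ψ-N n₁′∈
            (t₂′ , ψn₂′≈) = ψ-N (proj₁ (N₂-good n₂′∈))
            (t₃′ , ψn₃′≈) = ψ-N n₃′∈
            same-product = ≈M-trans (≈M-sym (product-f n₁ n₂ n₃ k₁∈ k₂∈ ψn₁≈ ψn₂≈ ψn₃≈))
                             (≈M-trans (≈M-reflexive (≡.cong product fs≡fs′))
                                       (product-f n₁′ n₂′ n₃′ k₁′∈ k₂′∈ ψn₁′≈ ψn₂′≈ ψn₃′≈))
            (t₁≈t₁′ , t₂≈t₂′ , t₃≈t₃′) =
              triple-injective G g-generic (λ upper → n₂-good (t₂ , ψn₂≈ , upper)) same-product
        in C-determines ψn₁≈ ψn₁′≈ t₁≈t₁′ , C-determines ψn₂≈ ψn₂′≈ t₂≈t₂′ ,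
           C-determines ψn₃≈ ψn₃′≈ t₃≈t₃′

      -- given the n's, the outer components of f s determine k₁ and k₂
      f-injective : ∀ {s s′} → s ∈ Source → s′ ∈ Source → f s ≡ f s′ → s ≡ s′
      f-injective {n₁ , n₂ , n₃ , k₁ , k₂} {n₁′ , n₂′ , n₃′ , k₁′ , k₂′} s∈ s′∈ fs≡fs′ =
        let (n₁≡n₁′ , n₂≡n₂′ , n₃≡n₃′) = f-determines-N s∈ s′∈ fs≡fs′
            (n₁∈ , _ , n₃∈ , _ , k₂∈) = ∈-Source s∈
            (_ , _ , _ , _ , k₂′∈) = ∈-Source s′∈
            k₁≡k₁′ = cancelˡ-SL² n₁ g (H-SL∋ (N⊆H n₁∈)) (H-SL∋ g∈H)
                       (≡.trans (≡.cong proj₁ fs≡fs′) (≡.cong (λ n → (n · g) · k₁′) (≡.sym n₁≡n₁′)))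
            k₂⁻¹≡k₂′⁻¹ = cancelʳ-SL² g⁻¹ n₃ (H-SL∋ g⁻¹∈H) (H-SL∋ (N⊆H n₃∈))
                           (≡.trans (≡.cong (proj₂ ∘ proj₂) fs≡fs′)
                                    (≡.cong (λ n → (inverse k₂′ · g⁻¹) · n) (≡.sym n₃≡n₃′)))
            k₂≡k₂′ = inverse-injective k₂∈ k₂′∈ k₂⁻¹≡k₂′⁻¹
        in ≡.cong₂ _,_ n₁≡n₁′ (≡.cong₂ _,_ n₂≡n₂′ (≡.cong₂ _,_ n₃≡n₃′ (≡.cong₂ _,_ k₁≡k₁′ k₂≡k₂′)))

      count : length N * (length N₂ * (length N * (length H * length H))) ≤ length T * (length T * length T)
      count = ≡.subst₂ _≤_ length-Source length-Target
        (injection-length Source Target f Source-unique f-into f-injective)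
        where
        Source-unique : Unique Source
        Source-unique = Unique.cartesianProduct⁺ N-unique (Unique.cartesianProduct⁺ N₂-unique
                          (Unique.cartesianProduct⁺ N-unique (Unique.cartesianProduct⁺ H-unique H-unique)))
        length-Source : length Source ≡ length N * (length N₂ * (length N * (length H * length H)))
        length-Source = ≡.trans (length-cartesianProduct N _) (≡.cong (length N *_)
          (≡.trans (length-cartesianProduct N₂ _) (≡.cong (length N₂ *_)
            (≡.trans (length-cartesianProduct N _) (≡.cong (length N *_) (length-cartesianProduct H H))))))
        length-Target : length Target ≡ length T * (length T * length T)
        length-Target = ≡.trans (length-cartesianProduct T _) (≡.cong (length T *_) (length-cartesianProduct T T))

  H≤T : length H ≤ length T
  H≤T = Counting.injection-length H T (λ h → (h · 𝟙) · 𝟙) H-unique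
    (λ h∈H → Equivalence.from (T-spec _) (_ , _ , _ , h∈H , 𝟙∈H , 𝟙∈H , ≡.refl))
    (λ {h} {h′} _ _ eq → ψ-injective
       (≈M-trans (≈M-sym (ψ-·𝟙·𝟙 h)) (≈M-trans (≈M-reflexive (≡.cong ψ eq)) (ψ-·𝟙·𝟙 h′))))
    where
    ψ-·𝟙·𝟙 : ∀ h → ψ ((h · 𝟙) · 𝟙) ≈M ψ h
    ψ-·𝟙·𝟙 h = ≈M-trans (ψ-·² h 𝟙 𝟙) (≈M-trans (·K-cong (·K-cong ≈M-refl ψ-𝟙) ψ-𝟙)
                (≈M-trans (·K-identityʳ _) (·K-identityʳ (ψ h))))

  -- It is decidable, so it may be proved under double negation:
  -- choose g ∈ H with ψ g not upper triangular, discard the exceptional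
  -- element of N, count the injection, and conclude by arithmetic.
  bound : length N ^ 3 * length H ^ 5 ≤ 8 * length T ^ 6
  bound = decidable-stable (_ ≤? _) λ ¬bound →
    generic-element λ (g , g∈H , g-generic) → let open Generic g∈H g-generic in
    drop-exceptional N-unique exceptional-unique λ (N₂ , N₂-unique , N₂-good , N≤1+N₂) →
    ¬bound (Arithmetic.final-inequality _ _ _ _ N≤1+N₂ (Injection.count N₂ N₂-unique N₂-good) H≤T)
    where
    open import Data.Nat using (_≤?_)
    open import Relation.Nullary.Decidable using (decidable-stable)

lemma3p15 : ∀ {c ℓ : Level} (p : ℕ) .{{_ : NonZero p}} → Prime p → 3 ≤ p →
    (K : CommutativeRing c ℓ) → FieldDefs.IsAlgClosureOfFp K p →
    (γ δ : CommutativeRing.Carrier K) →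
    CommutativeRing._≈_ K (CommutativeRing._*_ K γ δ) (CommutativeRing.1# K) →
    (x : Mat (CommutativeRing.Carrier K)) → FieldDefs.IsSLK K x →
    (H : List (Mat (Fin p))) → Unique H →
    All (Fp.IsSL p) H →
    Fp.𝟙 p ∈ H →
    (∀ {h} → h ∈ H → ∃ λ h' → h' ∈ H × Fp._·_ p h h' ≡ Fp.𝟙 p) →
    (∀ g → Fp.IsSL p g → ∃ λ ws → All (_∈ H) ws × foldr (Fp._·_ p) (Fp.𝟙 p) ws ≡ g) →
    (T : List (Mat (Fin p))) → Unique T →
    (∀ g → g ∈ T ⇔ (∃ λ h₁ → ∃ λ h₂ → ∃ λ h₃ → h₁ ∈ H × h₂ ∈ H × h₃ ∈ H ×
                      g ≡ Fp._·_ p (Fp._·_ p h₁ h₂) h₃)) →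
    (N : List (Mat (Fin p))) → Unique N →
    (∀ g → g ∈ N ⇔ (g ∈ H × FieldDefs.InConjC K x γ δ g)) →
    length N ^ 3 * length H ^ 5 ≤ 8 * length T ^ 6
lemma3p15 p p-prime _ K (isField , char , _) γ δ γδ≈1 x det-x
          H H-unique H-SL 𝟙∈H H-symmetric H-generates T _ T-spec N N-unique N-spec =
  ConjugateCosetBound.bound p p-prime K isField char γ δ γδ≈1 x det-x
    H H-unique H-SL 𝟙∈H H-symmetric H-generates T T-spec N N-unique N-spec
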